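{- The logic $\mathbf{il}^-(\mathbf{J15}^u,\mathbf{I2})$ does not have the fixed point property for $\mathcal{L}(\Box,\mathbf{I})$-formulas: there is an $\mathcal{L}(\Box,\mathbf{I})$-formula $A(p)$ in which $p$ is modalized (namely $A(p)=\mathbf{I}\neg p$) such that there is no $\mathcal{L}(\Box,\mathbf{I})$-formula $F$ with $\mathrm{var}(F)\subseteq\mathrm{var}(A(p))\setminus\{p\}$ and $\mathbf{il}^-(\mathbf{J15}^u,\mathbf{I2})\vdash F\leftrightarrow A(F)$.
   Context: $\mathcal{L}(\Box,\mathbf{I})$-formulas are built from propositional variables and $\bot$ by $\to$ and unary modal operators $\Box$, $\mathbf{I}$; $\Diamond A:\equiv\neg\Box\neg A$. The logic $\mathbf{il}^-$ has as axioms all tautologies, $\Box(A\to B)\to(\Box A\to\Box B)$, $\Box(\Box A\to A)\to\Box A$, $\Box\bot\leftrightarrow\mathbf{I}\bot$; rules Modus Ponens, Necessitation, and from $A\to B$ infer $\mathbf{I}A\to\mathbf{I}B$. $\mathbf{il}^-(\mathbf{J15}^u,\mathbf{I2})$ is obtained by adding the axiom schemata $\mathbf{J15}^u$: $\Box(A\lor\Diamond A)\to\mathbf{I}A$ and $\mathbf{I2}$: $\Box(A\to B)\to(\mathbf{I}A\to\mathbf{I}B)$. $p$ is modalized in $A$ if every occurrence of $p$ in $A$ lies in the scope of some $\Box$ or $\mathbf{I}$. $\mathrm{var}(A)$ is the set of propositional variables occurring in $A$; $A(F)$ denotes the result of substituting $F$ for $p$. -}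

module Defs where

open import Data.Nat using (ℕ; _≟_)
open import Data.Bool using (Bool; true; false; _∧_; _∨_; not; if_then_else_)
open import Data.List using (List; []; _∷_; _++_)
open import Data.List.Membership.Propositional using (_∈_)
open import Relation.Nullary using (¬_; yes; no)
open import Relation.Binary.PropositionalEquality using (_≡_)

infixr 5 _⇒_
data Formula : Set where
  var  : ℕ → Formula
  ⊥'   : Formula
  _⇒_  : Formula → Formula → Formula
  □    : Formula → Formula
  I    : Formula → Formula

¬' : Formula → Formula
¬' A = A ⇒ ⊥'

_∨'_ : Formula → Formula → Formula
A ∨' B = ¬' A ⇒ B

_∧'_ : Formula → Formula → Formula
A ∧' B = ¬' (A ⇒ ¬' B)

_⇔_ : Formula → Formula → Formula
A ⇔ B = (A ⇒ B) ∧' (B ⇒ A)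

◇ : Formula → Formula
◇ A = ¬' (□ (¬' A))

-- Tautologies: formulas true under every Boolean valuation of their
-- propositionally atomic subformulas (variables, □B, I B).
eval : (Formula → Bool) → Formula → Bool
eval v (var n) = v (var n)
eval v ⊥'      = false
eval v (A ⇒ B) = not (eval v A) ∨ eval v B
eval v (□ A)   = v (□ A)
eval v (I A)   = v (I A)

Tautology : Formula → Set
Tautology A = ∀ (v : Formula → Bool) → eval v A ≡ true

data ⊢ : Formula → Set where
  taut : ∀ {A} → Tautology A → ⊢ A
  axK  : ∀ {A B} → ⊢ (□ (A ⇒ B) ⇒ (□ A ⇒ □ B))
  axL  : ∀ {A} → ⊢ (□ (□ A ⇒ A) ⇒ □ A)
  axI⊥ : ⊢ (□ ⊥' ⇔ I ⊥')
  axJ15u : ∀ {A} → ⊢ (□ (A ∨' ◇ A) ⇒ I A)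
  axI2 : ∀ {A B} → ⊢ (□ (A ⇒ B) ⇒ (I A ⇒ I B))
  mp   : ∀ {A B} → ⊢ (A ⇒ B) → ⊢ A → ⊢ B
  nec  : ∀ {A} → ⊢ A → ⊢ (□ A)
  ruleI : ∀ {A B} → ⊢ (A ⇒ B) → ⊢ (I A ⇒ I B)

subst : ℕ → Formula → Formula → Formula
subst p F (var n) with n ≟ p
... | yes _ = F
... | no _  = var n
subst p F ⊥'      = ⊥'
subst p F (A ⇒ B) = subst p F A ⇒ subst p F B
subst p F (□ A)   = □ (subst p F A)
subst p F (I A)   = I (subst p F A)

vars : Formula → List ℕ
vars (var n) = n ∷ []
vars ⊥'      = []
vars (A ⇒ B) = vars A ++ vars B
vars (□ A)   = vars A
vars (I A)   = vars A

data Modalized (p : ℕ) : Formula → Set where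
  m-var : ∀ {n} → ¬ (n ≡ p) → Modalized p (var n)
  m-⊥   : Modalized p ⊥'
  m-⇒   : ∀ {A B} → Modalized p A → Modalized p B → Modalized p (A ⇒ B)
  m-□   : ∀ {A} → Modalized p (□ A)
  m-I   : ∀ {A} → Modalized p (I A)

-- Interpret formulas on the points 0, 1, 2, … of ℕ: variables are false everywhere,
-- □A holds at n iff A holds at every m < n, and I A holds at 0 and, at n + 1, iff A
-- holds at 0 or at n. This model validates il⁻(J15ᵘ, I2). In it every formula is
-- eventually constant, because □ and I only look at finitely many earlier points and
-- stabilise once their argument does. A fixed point F ↔ I ¬F, however, is true at 0
-- and therefore alternates: F holds at n + 1 iff ¬F holds at n.
module Submission where

open import Defs
open import Data.Bool using (Bool; true; false; T; not; _∧_; _∨_)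
open import Data.Bool.Properties using (∧-zeroʳ; ∧-identityʳ; ∨-identityʳ; not-¬; T-∧; T-∨)
open import Data.Nat using (ℕ; zero; suc; _+_)
open import Data.Nat.Properties using (+-assoc; +-comm; +-suc)
open import Data.Product using (Σ; ∃₂; _×_; _,_; proj₁; proj₂)
open import Data.Sum using (_⊎_; inj₁; inj₂)
open import Data.Unit using (tt)
open import Function.Bundles using (Equivalence)
open import Data.List.Membership.Propositional using (_∈_)
open import Relation.Nullary using (¬_)
open import Relation.Binary.PropositionalEquality
  using (_≡_; refl; sym; cong; cong₂; module ≡-Reasoning)

infixr 5 _⇒ᵇ_

_⇒ᵇ_ : Bool → Bool → Bool
a ⇒ᵇ b = not a ∨ b

_⇔ᵇ_ : Bool → Bool → Bool
a ⇔ᵇ b = ((a ⇒ᵇ b) ⇒ᵇ (b ⇒ᵇ a) ⇒ᵇ false) ⇒ᵇ false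

⇒ᵇ-intro : ∀ a b → (T a → T b) → T (a ⇒ᵇ b)
⇒ᵇ-intro false b _   = tt
⇒ᵇ-intro true  b a→b = a→b tt

⇒ᵇ-elim : ∀ a b → T (a ⇒ᵇ b) → T a → T b
⇒ᵇ-elim true b b-holds _ = b-holds

¬¬ᵇ-elim : ∀ a → T ((a ⇒ᵇ false) ⇒ᵇ false) → T a
¬¬ᵇ-elim true _ = tt

⇔ᵇ-refl : ∀ {a b} → a ≡ b → T (a ⇔ᵇ b)
⇔ᵇ-refl {true}  refl = tt
⇔ᵇ-refl {false} refl = tt

⇔ᵇ-≡ : ∀ a b → T (a ⇔ᵇ b) → a ≡ b
⇔ᵇ-≡ true  true  _ = refl
⇔ᵇ-≡ false false _ = refl

∧-split : ∀ a b → T (a ∧ b) → T a × T b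
∧-split a b = Equivalence.to (T-∧ {a} {b})

∧-pair : ∀ a b → T a → T b → T (a ∧ b)
∧-pair a b Ta Tb = Equivalence.from (T-∧ {a} {b}) (Ta , Tb)

∨-cases : ∀ a b → T (a ∨ b) → T a ⊎ T b
∨-cases a b = Equivalence.to (T-∨ {a} {b})

∨-inj₁ : ∀ a b → T a → T (a ∨ b)
∨-inj₁ a b Ta = Equivalence.from (T-∨ {a} {b}) (inj₁ Ta)

∨-inj₂ : ∀ a b → T b → T (a ∨ b)
∨-inj₂ a b Tb = Equivalence.from (T-∨ {a} {b}) (inj₂ Tb)

□ᵇ : (ℕ → Bool) → ℕ → Bool
□ᵇ f zero    = true
□ᵇ f (suc n) = □ᵇ f n ∧ f n

Iᵇ : (ℕ → Bool) → ℕ → Bool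
Iᵇ f zero    = true
Iᵇ f (suc n) = f 0 ∨ f n

⟦_⟧ : Formula → ℕ → Bool
⟦ var _ ⟧ n = false
⟦ ⊥' ⟧    n = false
⟦ A ⇒ B ⟧ n = ⟦ A ⟧ n ⇒ᵇ ⟦ B ⟧ n
⟦ □ A ⟧   n = □ᵇ ⟦ A ⟧ n
⟦ I A ⟧   n = Iᵇ ⟦ A ⟧ n

eval-⟦⟧ : ∀ A n → eval (λ B → ⟦ B ⟧ n) A ≡ ⟦ A ⟧ n
eval-⟦⟧ (var _) n = refl
eval-⟦⟧ ⊥'      n = refl
eval-⟦⟧ (A ⇒ B) n = cong₂ _⇒ᵇ_ (eval-⟦⟧ A n) (eval-⟦⟧ B n)
eval-⟦⟧ (□ A)   n = refl
eval-⟦⟧ (I A)   n = refl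

tautology-valid : ∀ A → Tautology A → ∀ n → T (⟦ A ⟧ n)
tautology-valid A taut-A n rewrite sym (eval-⟦⟧ A n) | taut-A (λ B → ⟦ B ⟧ n) = tt

□ᵇ-K : ∀ f g n → T (□ᵇ (λ m → f m ⇒ᵇ g m) n) → T (□ᵇ f n) → T (□ᵇ g n)
□ᵇ-K f g zero    _    _  = tt
□ᵇ-K f g (suc n) □f⇒g □f with ∧-split _ _ □f⇒g | ∧-split _ _ □f
... | □f⇒g-below , f⇒g-at-n | □f-below , f-at-n =
  ∧-pair _ _ (□ᵇ-K f g n □f⇒g-below □f-below) (⇒ᵇ-elim (f n) (g n) f⇒g-at-n f-at-n)

□ᵇ-Löb : ∀ f n → T (□ᵇ (λ m → □ᵇ f m ⇒ᵇ f m) n) → T (□ᵇ f n)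
□ᵇ-Löb f zero    _ = tt
□ᵇ-Löb f (suc n) □[□f⇒f] with ∧-split _ _ □[□f⇒f]
... | below , at-n = ∧-pair _ _ □f-below (⇒ᵇ-elim (□ᵇ f n) (f n) at-n □f-below)
  where
  □f-below : T (□ᵇ f n)
  □f-below = □ᵇ-Löb f n below

□ᵇ-nec : ∀ f → (∀ n → T (f n)) → ∀ n → T (□ᵇ f n)
□ᵇ-nec f valid zero    = tt
□ᵇ-nec f valid (suc n) = ∧-pair _ _ (□ᵇ-nec f valid n) (valid n)

□ᵇ-initial : ∀ f n → T (□ᵇ f (suc n)) → T (f 0)
□ᵇ-initial f zero    □f = proj₂ (∧-split _ _ □f)
□ᵇ-initial f (suc n) □f = □ᵇ-initial f n (proj₁ (∧-split _ _ □f))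

□ᵇ-false≡Iᵇ-false : ∀ n → □ᵇ (λ _ → false) n ≡ Iᵇ (λ _ → false) n
□ᵇ-false≡Iᵇ-false zero    = refl
□ᵇ-false≡Iᵇ-false (suc n) = ∧-zeroʳ (□ᵇ (λ _ → false) n)

Iᵇ-from-□ᵇ-initial : ∀ f g n → (T (g 0) → T (f 0)) → T (□ᵇ g n) → T (Iᵇ f n)
Iᵇ-from-□ᵇ-initial f g zero    _   _  = tt
Iᵇ-from-□ᵇ-initial f g (suc n) g→f □g = ∨-inj₁ (f 0) (f n) (g→f (□ᵇ-initial g n □g))

Iᵇ-mono : ∀ f g n → T (□ᵇ (λ m → f m ⇒ᵇ g m) n) → T (Iᵇ f n) → T (Iᵇ g n)
Iᵇ-mono f g zero    _    _  = tt
Iᵇ-mono f g (suc n) □f⇒g If with ∨-cases (f 0) (f n) If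
... | inj₁ f-at-0 = ∨-inj₁ (g 0) (g n) (⇒ᵇ-elim (f 0) (g 0) (□ᵇ-initial _ n □f⇒g) f-at-0)
... | inj₂ f-at-n = ∨-inj₂ (g 0) (g n) (⇒ᵇ-elim (f n) (g n) (proj₂ (∧-split _ _ □f⇒g)) f-at-n)

sound : ∀ {A} → ⊢ A → ∀ n → T (⟦ A ⟧ n)
sound (taut {A} taut-A) n = tautology-valid A taut-A n
sound (axK {A} {B}) n = ⇒ᵇ-intro _ _ λ □A⇒B → ⇒ᵇ-intro _ _ (□ᵇ-K ⟦ A ⟧ ⟦ B ⟧ n □A⇒B)
sound (axL {A})     n = ⇒ᵇ-intro _ _ (□ᵇ-Löb ⟦ A ⟧ n)
sound axI⊥          n = ⇔ᵇ-refl (□ᵇ-false≡Iᵇ-false n)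
-- ◇A is false at 0, so A ∨ ◇A holds at 0 only as ¬¬A.
sound (axJ15u {A})  n = ⇒ᵇ-intro _ _ (Iᵇ-from-□ᵇ-initial ⟦ A ⟧ ⟦ A ∨' ◇ A ⟧ n (¬¬ᵇ-elim (⟦ A ⟧ 0)))
sound (axI2 {A} {B}) n = ⇒ᵇ-intro _ _ λ □A⇒B → ⇒ᵇ-intro _ _ (Iᵇ-mono ⟦ A ⟧ ⟦ B ⟧ n □A⇒B)
sound (mp {A} {B} ⊢A⇒B ⊢A) n = ⇒ᵇ-elim (⟦ A ⟧ n) (⟦ B ⟧ n) (sound ⊢A⇒B n) (sound ⊢A n)
sound (nec {A} ⊢A)  n = □ᵇ-nec ⟦ A ⟧ (sound ⊢A) n
sound (ruleI {A} {B} ⊢A⇒B) n =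
  ⇒ᵇ-intro _ _ (Iᵇ-mono ⟦ A ⟧ ⟦ B ⟧ n (□ᵇ-nec _ (sound ⊢A⇒B) n))

EventuallyConstant : (ℕ → Bool) → Set
EventuallyConstant f = ∃₂ λ N b → ∀ k → f (k + N) ≡ b

constant-from-later : ∀ (f : ℕ → Bool) {N b} M →
  (∀ k → f (k + N) ≡ b) → ∀ k → f (k + (M + N)) ≡ b
constant-from-later f {N} M const k rewrite sym (+-assoc k M N) = const (k + M)

eventuallyConstant-zipWith : ∀ (_∙_ : Bool → Bool → Bool) f g →
  EventuallyConstant f → EventuallyConstant g → EventuallyConstant (λ n → f n ∙ g n)
eventuallyConstant-zipWith _∙_ f g (N , a , f≡a) (M , b , g≡b) =
  M + N , a ∙ b , λ k → cong₂ _∙_ (constant-from-later f M f≡a k) (g≡b-from-M+N k)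
  where
  g≡b-from-M+N : ∀ k → g (k + (M + N)) ≡ b
  g≡b-from-M+N k rewrite +-comm M N = constant-from-later g N g≡b k

□ᵇ-eventuallyConstant : ∀ f → EventuallyConstant f → EventuallyConstant (□ᵇ f)
□ᵇ-eventuallyConstant f (N , true , f≡true) = N , □ᵇ f N , □f-stable
  where
  □f-stable : ∀ k → □ᵇ f (k + N) ≡ □ᵇ f N
  □f-stable zero = refl
  □f-stable (suc k) rewrite f≡true k | ∧-identityʳ (□ᵇ f (k + N)) = □f-stable k
□ᵇ-eventuallyConstant f (N , false , f≡false) = suc N , false , □f-false
  where
  □f-false : ∀ k → □ᵇ f (k + suc N) ≡ false
  □f-false k rewrite +-suc k N | f≡false k = ∧-zeroʳ (□ᵇ f (k + N))

Iᵇ-eventuallyConstant : ∀ f → EventuallyConstant f → EventuallyConstant (Iᵇ f)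
Iᵇ-eventuallyConstant f (N , b , f≡b) = suc N , f 0 ∨ b , If≡f0∨b
  where
  If≡f0∨b : ∀ k → Iᵇ f (k + suc N) ≡ f 0 ∨ b
  If≡f0∨b k rewrite +-suc k N = cong (f 0 ∨_) (f≡b k)

⟦⟧-eventuallyConstant : ∀ A → EventuallyConstant ⟦ A ⟧
⟦⟧-eventuallyConstant (var _) = 0 , false , λ _ → refl
⟦⟧-eventuallyConstant ⊥'      = 0 , false , λ _ → refl
⟦⟧-eventuallyConstant (A ⇒ B) =
  eventuallyConstant-zipWith _⇒ᵇ_ ⟦ A ⟧ ⟦ B ⟧ (⟦⟧-eventuallyConstant A) (⟦⟧-eventuallyConstant B)
⟦⟧-eventuallyConstant (□ A)   = □ᵇ-eventuallyConstant ⟦ A ⟧ (⟦⟧-eventuallyConstant A)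
⟦⟧-eventuallyConstant (I A)   = Iᵇ-eventuallyConstant ⟦ A ⟧ (⟦⟧-eventuallyConstant A)

alternating-not-eventuallyConstant : ∀ (f : ℕ → Bool) → (∀ n → f (suc n) ≡ not (f n)) →
  ¬ EventuallyConstant f
alternating-not-eventuallyConstant f alternates (N , b , f≡b) = not-¬ refl b≡not-b
  where
  open ≡-Reasoning
  b≡not-b : b ≡ not b
  b≡not-b = begin
    b              ≡⟨ sym (f≡b 1) ⟩
    f (suc N)      ≡⟨ alternates N ⟩
    not (f N)      ≡⟨ cong not (f≡b 0) ⟩
    not b          ∎

I¬-fixedPoint-alternates : ∀ (f : ℕ → Bool) → (∀ n → f n ≡ Iᵇ (λ m → f m ⇒ᵇ false) n) →
  ∀ n → f (suc n) ≡ not (f n)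
I¬-fixedPoint-alternates f fixed n = begin
  f (suc n)                            ≡⟨ fixed (suc n) ⟩
  (f 0 ⇒ᵇ false) ∨ (f n ⇒ᵇ false)      ≡⟨ cong (λ b → (b ⇒ᵇ false) ∨ (f n ⇒ᵇ false)) (fixed 0) ⟩
  (true ⇒ᵇ false) ∨ (f n ⇒ᵇ false)     ≡⟨ ∨-identityʳ (not (f n)) ⟩
  not (f n)                            ∎
  where open ≡-Reasoning

I¬-has-no-fixedPoint : ∀ F → ¬ ⊢ (F ⇔ I (¬' F))
I¬-has-no-fixedPoint F ⊢F⇔I¬F =
  alternating-not-eventuallyConstant ⟦ F ⟧ (I¬-fixedPoint-alternates ⟦ F ⟧ F≡I¬F)
    (⟦⟧-eventuallyConstant F)
  where
  F≡I¬F : ∀ n → ⟦ F ⟧ n ≡ ⟦ I (¬' F) ⟧ n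
  F≡I¬F n = ⇔ᵇ-≡ (⟦ F ⟧ n) (⟦ I (¬' F) ⟧ n) (sound ⊢F⇔I¬F n)

corollary5p7 : Σ Formula (λ A → (A ≡ I (¬' (var 0))) × Modalized 0 A × ¬ (Σ Formula (λ F → (∀ q → q ∈ vars F → (q ∈ vars A × ¬ (q ≡ 0))) × ⊢ (F ⇔ subst 0 F A))))
corollary5p7 = I (¬' (var 0)) , refl , m-I , λ (F , _ , ⊢F⇔I¬F) → I¬-has-no-fixedPoint F ⊢F⇔I¬F
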